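{- Let $F$ and $g$ be positive integers such that $g \leq F \leq 2g-1$. Then: (1) $\mathcal{K}(F,g) = \{x \in \{0,1\}^{2g-1} : x_F = 1,\ x_i = 0 \text{ for all } F < i < 2g,\ x_i + x_j - x_{i+j} \geq 0 \text{ for all } 1 \leq i \leq j < 2g \text{ with } i + j \leq F, \text{ and } \sum_{i=1}^{F} x_i = g\}$; (2) $\mathcal{K}(g) = \{x \in \{0,1\}^{2g-1} : x_i + x_j - x_{i+j} \geq 0 \text{ for all } 1 \leq i \leq j < 2g \text{ with } i + j \leq 2g-1, \text{ and } \sum_{i=1}^{2g-1} x_i = g\}$.
   Context: A numerical semigroup is a subset $S \subseteq \mathbb{N}$ (with $\mathbb{N}$ the nonnegative integers) closed under addition, containing $0$, with $\mathbb{N}\setminus S$ finite. The genus $\mathrm{g}(S)$ is $\#(\mathbb{N}\setminus S)$; the Frobenius number is the largest integer not in $S$. If $S$ has genus $g \geq 1$ then $2g \in S$. For such $S$, for $i = 1,\ldots,2g-1$ let $w_i$ be the least element of $S$ congruent to $i$ modulo $2g$ (so $\{0,w_1,\ldots,w_{2g-1}\}$ is the Apéry set of $S$ with respect to $2g$), and define the Kunz-coordinates vector $\mathcal{K}(S) = (x_1,\ldots,x_{2g-1}) \in \mathbb{N}^{2g-1}$ by $x_i = \frac{w_i - i}{2g}$. Let $\mathcal{K}(g) = \{\mathcal{K}(S) : S \text{ a numerical semigroup of genus } g\}$ and $\mathcal{K}(F,g) = \{\mathcal{K}(S) : S \text{ a numerical semigroup with Frobenius number } F \text{ and genus } g\}$.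 -}

module Defs where

open import Data.Nat using (ℕ; zero; suc; _+_; _*_; _∸_; _≤_; _<_)
open import Data.Nat.Properties using (_<?_)
open import Data.Bool using (Bool; true; false)
open import Data.Fin using (Fin; fromℕ<)
open import Data.List using (List; length)
open import Data.List.Membership.Propositional using (_∈_)
open import Data.List.Relation.Unary.Unique.Propositional using (Unique)
open import Data.Product using (Σ; ∃; _×_)
open import Function.Bundles using (_⇔_)
open import Relation.Nullary using (yes; no)
open import Relation.Binary.PropositionalEquality using (_≡_)

record NumericalSemigroup : Set where
  field
    mem      : ℕ → Bool
    zero∈    : mem 0 ≡ true
    closed   : ∀ a b → mem a ≡ true → mem b ≡ true → mem (a + b) ≡ true
    cofinite : ∃ λ N → ∀ n → N ≤ n → mem n ≡ true
open NumericalSemigroup public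

HasGenus : NumericalSemigroup → ℕ → Set
HasGenus S g = Σ (List ℕ) λ gaps →
  Unique gaps × length gaps ≡ g × (∀ n → (n ∈ gaps) ⇔ (mem S n ≡ false))

HasFrobenius : NumericalSemigroup → ℕ → Set
HasFrobenius S F = (mem S F ≡ false) × (∀ n → F < n → mem S n ≡ true)

-- Vectors in N^n are functions Fin n → ℕ; coordinate i (1-based, 1 ≤ i ≤ n)
-- is  at x i = x (i-1).  Out-of-range indices give 0 (never used below).
at : ∀ {n} → (Fin n → ℕ) → ℕ → ℕ
at x zero = 0
at {n} x (suc m) with m <? n
... | yes p = x (fromℕ< p)
... | no _  = 0

sum1 : (ℕ → ℕ) → ℕ → ℕ
sum1 f zero    = 0
sum1 f (suc n) = sum1 f n + f (suc n)

-- x = K(S) (Kunz coordinates w.r.t. 2g): for each 1 ≤ i ≤ 2g-1,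
-- w_i = 2g·x_i + i is the least element of S congruent to i mod 2g.
IsKunz : NumericalSemigroup → (g : ℕ) → (Fin (2 * g ∸ 1) → ℕ) → Set
IsKunz S g x = ∀ i → 1 ≤ i → i ≤ 2 * g ∸ 1 →
  (mem S (2 * g * at x i + i) ≡ true) ×
  (∀ k → k < at x i → mem S (2 * g * k + i) ≡ false)

InKg : (g : ℕ) → (Fin (2 * g ∸ 1) → ℕ) → Set
InKg g x = Σ NumericalSemigroup λ S → HasGenus S g × IsKunz S g x

InKFg : (F g : ℕ) → (Fin (2 * g ∸ 1) → ℕ) → Set
InKFg F g x = Σ NumericalSemigroup λ S →
  HasFrobenius S F × HasGenus S g × IsKunz S g x

Cond1 : (F g : ℕ) → (Fin (2 * g ∸ 1) → ℕ) → Set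
Cond1 F g x =
  (∀ k → x k ≤ 1) ×
  (at x F ≡ 1) ×
  (∀ i → F < i → i < 2 * g → at x i ≡ 0) ×
  (∀ i j → 1 ≤ i → i ≤ j → j < 2 * g → i + j ≤ F →
     at x (i + j) ≤ at x i + at x j) ×
  (sum1 (at x) F ≡ g)

Cond2 : (g : ℕ) → (Fin (2 * g ∸ 1) → ℕ) → Set
Cond2 g x =
  (∀ k → x k ≤ 1) ×
  (∀ i j → 1 ≤ i → i ≤ j → j < 2 * g → i + j ≤ 2 * g ∸ 1 →
     at x (i + j) ≤ at x i + at x j) ×
  (sum1 (at x) (2 * g ∸ 1) ≡ g)

-- Write gap S n for the indicator of n ∉ S.  If every n ≥ 2g lies in S, the least element
-- of S congruent to i modulo 2g is i or 2g + i, so the Kunz coordinate x_i is exactly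
-- gap S i; this holds for genus g because a gap n forces one of i, n − i to be a gap for
-- every i ≤ n, whence n + 1 ≤ 2g.  The conditions of (2) then say that a 0/1 vector is the
-- gap indicator on [1, 2g − 1] of a set whose complement is closed under addition and has
-- g elements, and (1) adds that the last gap is F.

module Submission where

open import Defs
open import Algebra.Properties.CommutativeSemigroup as CommSemigroupProperties using ()
open import Data.Bool using (true; false; if_then_else_)
import Data.Bool as Bool
open import Data.Fin using (Fin; toℕ)
open import Data.Fin.Properties using (fromℕ<-toℕ; toℕ<n)
open import Data.List using (List; []; _∷_; length; filter; applyDownFrom)
open import Data.List.Membership.Propositional using (_∈_; _─_)
open import Data.List.Membership.Propositional.Properties
  using (∈-filter⁺; ∈-filter⁻; ∈-applyDownFrom⁺)
open import Data.List.Properties using (length-removeAt′)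
open import Data.List.Relation.Binary.Subset.Propositional using (_⊆_)
open import Data.List.Relation.Unary.All as All using ()
open import Data.List.Relation.Unary.Any using (here; there; index)
open import Data.List.Relation.Unary.AllPairs using (_∷_)
open import Data.List.Relation.Unary.Unique.Propositional using (Unique)
open import Data.List.Relation.Unary.Unique.Propositional.Properties
  using (filter⁺; applyDownFrom⁺₁)
open import Data.Nat using (ℕ; zero; suc; _+_; _*_; _∸_; _≤_; _<_; z≤n; s≤s; _≟_; _≤?_)
open import Data.Nat.Properties
open import Data.Product using (_×_; _,_; proj₁; proj₂)
open import Data.Sum using (inj₁; inj₂)
open import Function using (_∘_)
open import Function.Bundles using (_⇔_; mk⇔; Equivalence)
open import Relation.Nullary using (Dec; yes; no; does; contradiction)
open import Relation.Nullary.Decidable using (dec-true)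
open import Relation.Binary.PropositionalEquality

open CommSemigroupProperties +-commutativeSemigroup using (interchange; xy∙z≈y∙xz)
open Equivalence using (to; from)

does≡true⇒ : ∀ {A : Set} (a? : Dec A) → does a? ≡ true → A
does≡true⇒ (yes a) _ = a
does≡true⇒ (no _) ()

<⇒≤∸1 : ∀ {m n} → m < n → m ≤ n ∸ 1
<⇒≤∸1 (s≤s m≤n) = m≤n

≤∸1⇒< : ∀ {m n} → 0 < n → m ≤ n ∸ 1 → m < n
≤∸1⇒< {n = suc n} _ m≤n = s≤s m≤n

∈-─ : ∀ {A : Set} {x z : A} {ys : List A} (x∈ys : x ∈ ys) → z ∈ ys → z ≢ x → z ∈ ys ─ x∈ys
∈-─ (here refl) (here refl) z≢x = contradiction refl z≢x
∈-─ (here _)    (there z∈ys) _  = z∈ys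
∈-─ (there _)   (here z≡y)  _   = here z≡y
∈-─ (there x∈ys) (there z∈ys) z≢x = there (∈-─ x∈ys z∈ys z≢x)

Unique∧⊆⇒length≤ : ∀ {A : Set} {xs ys : List A} → Unique xs → xs ⊆ ys → length xs ≤ length ys
Unique∧⊆⇒length≤ {xs = []} _ _ = z≤n
Unique∧⊆⇒length≤ {xs = x ∷ xs} {ys} (x∉xs ∷ xs!) xs⊆ys = begin
  suc (length xs)          ≤⟨ s≤s (Unique∧⊆⇒length≤ xs! xs⊆ys─x) ⟩
  suc (length (ys ─ x∈ys)) ≡⟨ length-removeAt′ ys (index x∈ys) ⟨
  length ys                ∎
  where
  open ≤-Reasoning
  x∈ys = xs⊆ys (here refl)
  xs⊆ys─x : xs ⊆ ys ─ x∈ys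
  xs⊆ys─x z∈xs = ∈-─ x∈ys (xs⊆ys (there z∈xs)) (All.lookup x∉xs z∈xs ∘ sym)

module _ {f h : ℕ → ℕ} where

  sum1-cong : ∀ n → (∀ i → 1 ≤ i → i ≤ n → f i ≡ h i) → sum1 f n ≡ sum1 h n
  sum1-cong zero _ = refl
  sum1-cong (suc n) f≗h =
    cong₂ _+_ (sum1-cong n (λ i 1≤i i≤n → f≗h i 1≤i (m≤n⇒m≤1+n i≤n))) (f≗h (suc n) (s≤s z≤n) ≤-refl)

  sum1-mono : ∀ {n} → (∀ i → 1 ≤ i → i ≤ n → f i ≤ h i) → sum1 f n ≤ sum1 h n
  sum1-mono {zero} _ = z≤n
  sum1-mono {suc n} f≤h =
    +-mono-≤ (sum1-mono (λ i 1≤i i≤n → f≤h i 1≤i (m≤n⇒m≤1+n i≤n))) (f≤h (suc n) (s≤s z≤n) ≤-refl)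

  sum1-+ : ∀ n → sum1 (λ i → f i + h i) n ≡ sum1 f n + sum1 h n
  sum1-+ zero = refl
  sum1-+ (suc n) = trans (cong (_+ (f (suc n) + h (suc n))) (sum1-+ n))
                         (interchange (sum1 f n) (sum1 h n) (f (suc n)) (h (suc n)))

sum1-one : ∀ n → sum1 (λ _ → 1) n ≡ n
sum1-one zero = refl
sum1-one (suc n) = trans (cong (_+ 1) (sum1-one n)) (+-comm n 1)

sum1-vanish : ∀ {f m n} → m ≤ n → (∀ i → m < i → i ≤ n → f i ≡ 0) → sum1 f n ≡ sum1 f m
sum1-vanish {n = zero} m≤0 _ rewrite n≤0⇒n≡0 m≤0 = refl
sum1-vanish {f} {m} {suc n} m≤1+n f≗0 with m≤n⇒m<n∨m≡n m≤1+n
... | inj₂ refl = refl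
... | inj₁ (s≤s m≤n) = begin
  sum1 f n + f (suc n) ≡⟨ cong₂ _+_ (sum1-vanish m≤n (λ i m<i i≤n → f≗0 i m<i (m≤n⇒m≤1+n i≤n)))
                                    (f≗0 (suc n) (s≤s m≤n) ≤-refl) ⟩
  sum1 f m + 0         ≡⟨ +-identityʳ _ ⟩
  sum1 f m             ∎
  where open ≡-Reasoning

sum1-shift : ∀ f n → sum1 f (suc n) ≡ f 1 + sum1 (f ∘ suc) n
sum1-shift f zero = +-comm 0 (f 1)
sum1-shift f (suc n) = trans (cong (_+ f (suc (suc n))) (sum1-shift f n)) (+-assoc (f 1) _ _)

-- Both sides are f 0 + f 1 + ⋯ + f n.
sum1-reflect : ∀ f n → sum1 (λ i → f (n ∸ i)) n + f n ≡ f 0 + sum1 f n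
sum1-reflect f zero = sym (+-identityʳ (f 0))
sum1-reflect f (suc n) = begin
  (sum1 (λ i → f (suc n ∸ i)) n + f (n ∸ n)) + f (suc n)
    ≡⟨ cong₂ (λ s t → (s + t) + f (suc n)) (sum1-cong n (λ i _ i≤n → cong f (+-∸-assoc 1 i≤n)))
                                           (cong f (n∸n≡0 n)) ⟩
  (sum1 (λ i → f (suc (n ∸ i))) n + f 0) + f (suc n)
    ≡⟨ xy∙z≈y∙xz (sum1 (λ i → f (suc (n ∸ i))) n) (f 0) (f (suc n)) ⟩
  f 0 + (sum1 (λ i → f (suc (n ∸ i))) n + f (suc n))
    ≡⟨ cong (f 0 +_) (sum1-reflect (f ∘ suc) n) ⟩
  f 0 + (f 1 + sum1 (f ∘ suc) n)
    ≡⟨ cong (f 0 +_) (sum1-shift f n) ⟨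
  f 0 + sum1 f (suc n) ∎
  where open ≡-Reasoning

gap : NumericalSemigroup → ℕ → ℕ
gap S n = if mem S n then 0 else 1

module _ (S : NumericalSemigroup) where

  gap≡0⇔∈ : ∀ {n} → gap S n ≡ 0 ⇔ mem S n ≡ true
  gap≡0⇔∈ {n} with mem S n
  ... | true  = mk⇔ (λ _ → refl) (λ _ → refl)
  ... | false = mk⇔ (λ ()) (λ ())

  gap≡1⇔∉ : ∀ {n} → gap S n ≡ 1 ⇔ mem S n ≡ false
  gap≡1⇔∉ {n} with mem S n
  ... | true  = mk⇔ (λ ()) (λ ())
  ... | false = mk⇔ (λ _ → refl) (λ _ → refl)

  gap≤1 : ∀ n → gap S n ≤ 1
  gap≤1 n with mem S n
  ... | true  = z≤n
  ... | false = ≤-refl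

  gap-+ : ∀ i j → gap S (i + j) ≤ gap S i + gap S j
  gap-+ i j with mem S i in i∈S | mem S j in j∈S
  ... | true  | true  = ≤-reflexive (from gap≡0⇔∈ (closed S i j i∈S j∈S))
  ... | true  | false = gap≤1 (i + j)
  ... | false | _     = ≤-trans (gap≤1 (i + j)) (m≤m+n 1 _)

  gap? : ∀ n → Dec (mem S n ≡ false)
  gap? n = mem S n Bool.≟ false

  gapsUpTo : ℕ → List ℕ
  gapsUpTo n = filter gap? (applyDownFrom suc n)

  ∈-gapsUpTo⁻ : ∀ n {z} → z ∈ gapsUpTo n → mem S z ≡ false
  ∈-gapsUpTo⁻ n = proj₂ ∘ ∈-filter⁻ gap? {xs = applyDownFrom suc n}

  ∈-gapsUpTo⁺ : ∀ {n z} → 1 ≤ z → z ≤ n → mem S z ≡ false → z ∈ gapsUpTo n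
  ∈-gapsUpTo⁺ (s≤s _) i<n z∉S = ∈-filter⁺ gap? (∈-applyDownFrom⁺ suc i<n) z∉S

  gapsUpTo-unique : ∀ n → Unique (gapsUpTo n)
  gapsUpTo-unique n = filter⁺ gap?
    (applyDownFrom⁺₁ suc n (λ j<i _ i≡j → <⇒≢ j<i (sym (suc-injective i≡j))))

  length-gapsUpTo : ∀ n → length (gapsUpTo n) ≡ sum1 (gap S) n
  length-gapsUpTo zero = refl
  length-gapsUpTo (suc n) with mem S (suc n)
  ... | true  = trans (length-gapsUpTo n) (sym (+-identityʳ _))
  ... | false = trans (cong suc (length-gapsUpTo n)) (+-comm 1 _)

  gap⇒1≤ : ∀ {n} → mem S n ≡ false → 1 ≤ n
  gap⇒1≤ {zero} 0∉S with () ← trans (sym (zero∈ S)) 0∉S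
  gap⇒1≤ {suc n} _ = s≤s z≤n

  gap-zero : gap S 0 ≡ 0
  gap-zero = from gap≡0⇔∈ (zero∈ S)

  hasGenus-gapsUpTo : ∀ {B} → (∀ n → mem S n ≡ false → n ≤ B) → HasGenus S (sum1 (gap S) B)
  hasGenus-gapsUpTo {B} gaps≤B = gapsUpTo B , gapsUpTo-unique B , length-gapsUpTo B ,
    λ n → mk⇔ (∈-gapsUpTo⁻ B) (λ n∉S → ∈-gapsUpTo⁺ (gap⇒1≤ n∉S) (gaps≤B n n∉S) n∉S)

  genus-unique : ∀ {g h} → HasGenus S g → HasGenus S h → g ≡ h
  genus-unique (L , L! , refl , L⇔) (M , M! , refl , M⇔) = ≤-antisym
    (Unique∧⊆⇒length≤ L! (λ {n} n∈L → from (M⇔ n) (to (L⇔ n) n∈L)))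
    (Unique∧⊆⇒length≤ M! (λ {n} n∈M → from (L⇔ n) (to (M⇔ n) n∈M)))

  sum1-gap≤genus : ∀ {g} → HasGenus S g → ∀ n → sum1 (gap S) n ≤ g
  sum1-gap≤genus (L , _ , refl , L⇔) n = subst (_≤ length L) (length-gapsUpTo n)
    (Unique∧⊆⇒length≤ (gapsUpTo-unique n) (λ {z} z∈gaps → from (L⇔ z) (∈-gapsUpTo⁻ n z∈gaps)))

  1≤gap[i]+gap[n∸i] : ∀ {n} → mem S n ≡ false → ∀ i → i ≤ n → 1 ≤ gap S i + gap S (n ∸ i)
  1≤gap[i]+gap[n∸i] {n} n∉S i i≤n with mem S i in i∈S | mem S (n ∸ i) in n-i∈S
  ... | true  | true  with () ← trans (sym (subst (λ m → mem S m ≡ true) (m+[n∸m]≡n i≤n)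
                                                   (closed S i (n ∸ i) i∈S n-i∈S))) n∉S
  ... | true  | false = ≤-refl
  ... | false | _     = s≤s z≤n

  gap<2*genus : ∀ {g n} → HasGenus S g → mem S n ≡ false → n < 2 * g
  gap<2*genus {g} {n} genus n∉S = begin-strict
    n                                      ≡⟨ sum1-one n ⟨
    sum1 (λ _ → 1) n                       ≤⟨ sum1-mono (λ i _ i≤n → 1≤gap[i]+gap[n∸i] n∉S i i≤n) ⟩
    sum1 (λ i → gap S i + gap S (n ∸ i)) n ≡⟨ sum1-+ n ⟩
    sum1 (gap S) n + reflected             <⟨ +-monoʳ-< (sum1 (gap S) n) (n<1+n reflected) ⟩
    sum1 (gap S) n + suc reflected         ≡⟨ cong (sum1 (gap S) n +_) suc-reflected ⟩
    sum1 (gap S) n + sum1 (gap S) n        ≤⟨ +-mono-≤ (sum1-gap≤genus genus n)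
                                                       (sum1-gap≤genus genus n) ⟩
    g + g                                  ≡⟨ cong (g +_) (+-identityʳ g) ⟨
    2 * g                                  ∎
    where
    open ≤-Reasoning
    reflected = sum1 (λ i → gap S (n ∸ i)) n
    suc-reflected : suc reflected ≡ sum1 (gap S) n
    suc-reflected = begin-equality
      suc reflected            ≡⟨ +-comm 1 reflected ⟩
      reflected + 1            ≡⟨ cong (reflected +_) (from gap≡1⇔∉ n∉S) ⟨
      reflected + gap S n      ≡⟨ sum1-reflect (gap S) n ⟩
      gap S 0 + sum1 (gap S) n ≡⟨ cong (_+ sum1 (gap S) n) gap-zero ⟩
      sum1 (gap S) n           ∎

  genus≡sum1-gap : ∀ {g} → HasGenus S g → g ≡ sum1 (gap S) (2 * g ∸ 1)
  genus≡sum1-gap genus =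
    genus-unique genus (hasGenus-gapsUpTo (λ n n∉S → <⇒≤∸1 (gap<2*genus genus n∉S)))

  genus-tail : ∀ {g} → HasGenus S g → ∀ n → 2 * g ≤ n → mem S n ≡ true
  genus-tail genus n 2g≤n with mem S n in n∈S
  ... | true  = refl
  ... | false = contradiction (gap<2*genus genus n∈S) (≤⇒≯ 2g≤n)

module _ (S : NumericalSemigroup) {m : ℕ} (tail : ∀ n → m ≤ n → mem S n ≡ true) where

  private
    m≤m*1+i : ∀ i → m ≤ m * 1 + i
    m≤m*1+i i = ≤-trans (≤-reflexive (sym (*-identityʳ m))) (m≤m+n (m * 1) i)

    m*0+i≡i : ∀ i → m * 0 + i ≡ i
    m*0+i≡i i = cong (_+ i) (*-zeroʳ m)

  gap-isKunz : ∀ i →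
    (mem S (m * gap S i + i) ≡ true) × (∀ k → k < gap S i → mem S (m * k + i) ≡ false)
  gap-isKunz i with mem S i in i∈S
  ... | true  = subst (λ n → mem S n ≡ true) (sym (m*0+i≡i i)) i∈S , λ _ ()
  ... | false = tail (m * 1 + i) (m≤m*1+i i) ,
    λ { zero _ → subst (λ n → mem S n ≡ false) (sym (m*0+i≡i i)) i∈S ; (suc _) (s≤s ()) }

  kunz-unique : ∀ i v → mem S (m * v + i) ≡ true → (∀ k → k < v → mem S (m * k + i) ≡ false) →
    v ≡ gap S i
  kunz-unique i zero w∈S _ = sym (from (gap≡0⇔∈ S) (subst (λ n → mem S n ≡ true) (m*0+i≡i i) w∈S))
  kunz-unique i (suc zero) _ below =
    sym (from (gap≡1⇔∉ S) (subst (λ n → mem S n ≡ false) (m*0+i≡i i) (below 0 (s≤s z≤n))))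
  kunz-unique i (suc (suc v)) _ below
    with () ← trans (sym (tail (m * 1 + i) (m≤m*1+i i))) (below 1 (s≤s (s≤s z≤n)))

isKunz⇔gap : ∀ S g {x : Fin (2 * g ∸ 1) → ℕ} → (∀ n → 2 * g ≤ n → mem S n ≡ true) →
  IsKunz S g x ⇔ (∀ i → 1 ≤ i → i ≤ 2 * g ∸ 1 → at x i ≡ gap S i)
isKunz⇔gap S g {x} tail = mk⇔
  (λ K i 1≤i i≤ → kunz-unique S tail i (at x i) (proj₁ (K i 1≤i i≤)) (proj₂ (K i 1≤i i≤)))
  (λ x≗gap i 1≤i i≤ → subst (IsKunzAt i) (sym (x≗gap i 1≤i i≤)) (gap-isKunz S tail i))
  where
  IsKunzAt : ℕ → ℕ → Set
  IsKunzAt i v = (mem S (2 * g * v + i) ≡ true) × (∀ k → k < v → mem S (2 * g * k + i) ≡ false)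

module _ {n : ℕ} (x : Fin n → ℕ) where

  at-toℕ : ∀ k → at x (suc (toℕ k)) ≡ x k
  at-toℕ k with toℕ k <? n
  ... | yes k<n = cong x (fromℕ<-toℕ k k<n)
  ... | no  k≮n = contradiction (toℕ<n k) k≮n

  at-beyond : ∀ i → n < i → at x i ≡ 0
  at-beyond (suc i) n<1+i with i <? n
  ... | yes i<n = contradiction i<n (≤⇒≯ (≤-pred n<1+i))
  ... | no  _   = refl

  at≤1 : (∀ k → x k ≤ 1) → ∀ i → at x i ≤ 1
  at≤1 x≤1 zero = z≤n
  at≤1 x≤1 (suc i) with i <? n
  ... | yes _ = x≤1 _
  ... | no  _ = z≤n

module ZerosOf (a : ℕ → ℕ) (a0≡0 : a 0 ≡ 0)
               (zeros-closed : ∀ i j → a i ≡ 0 → a j ≡ 0 → a (i + j) ≡ 0)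
               {B : ℕ} (a-beyond : ∀ n → B < n → a n ≡ 0) where

  zerosOf : NumericalSemigroup
  zerosOf = record
    { mem      = λ n → does (a n ≟ 0)
    ; zero∈    = dec-true (a 0 ≟ 0) a0≡0
    ; closed   = λ i j i∈ j∈ → dec-true (a (i + j) ≟ 0)
                   (zeros-closed i j (does≡true⇒ (a i ≟ 0) i∈) (does≡true⇒ (a j ≟ 0) j∈))
    ; cofinite = suc B , λ n B<n → dec-true (a n ≟ 0) (a-beyond n B<n)
    }

  zerosOf-tail : ∀ n → B < n → mem zerosOf n ≡ true
  zerosOf-tail n B<n = dec-true (a n ≟ 0) (a-beyond n B<n)

  gap-zerosOf : (∀ n → a n ≤ 1) → ∀ n → gap zerosOf n ≡ a n
  gap-zerosOf a≤1 n with a n | a≤1 n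
  ... | zero        | _        = refl
  ... | suc zero    | _        = refl
  ... | suc (suc _) | s≤s ()

  zerosOf-hasGenus : (∀ n → a n ≤ 1) → HasGenus zerosOf (sum1 a B)
  zerosOf-hasGenus a≤1 = subst (HasGenus zerosOf) (sum1-cong B (λ i _ _ → gap-zerosOf a≤1 i))
    (hasGenus-gapsUpTo zerosOf gaps≤B)
    where
    gaps≤B : ∀ n → mem zerosOf n ≡ false → n ≤ B
    gaps≤B n n∉S with n ≤? B
    ... | yes n≤B = n≤B
    ... | no  n≰B with () ← trans (sym (zerosOf-tail n (≰⇒> n≰B))) n∉S

SubadditiveUpTo : ℕ → ℕ → (ℕ → ℕ) → Set
SubadditiveUpTo g N a = ∀ i j → 1 ≤ i → i ≤ j → j < 2 * g → i + j ≤ N → a (i + j) ≤ a i + a j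

LastNonzeroAt : ℕ → (g : ℕ) → (Fin (2 * g ∸ 1) → ℕ) → Set
LastNonzeroAt F g x = at x F ≡ 1 × (∀ i → F < i → i < 2 * g → at x i ≡ 0)

module _ {g : ℕ} (0<g : 0 < g) where

  private
    0<2g : 0 < 2 * g
    0<2g = ≤-trans 0<g (m≤m+n g _)

  subadditive-extend : ∀ {F a} → SubadditiveUpTo g F a → (∀ i → F < i → i < 2 * g → a i ≡ 0) →
    SubadditiveUpTo g (2 * g ∸ 1) a
  subadditive-extend {F} sub a≗0 i j 1≤i i≤j j<2g i+j≤ with i + j ≤? F
  ... | yes i+j≤F = sub i j 1≤i i≤j j<2g i+j≤F
  ... | no  i+j≰F = ≤-trans (≤-reflexive (a≗0 (i + j) (≰⇒> i+j≰F) (≤∸1⇒< 0<2g i+j≤))) z≤n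

  subadditive⇒zeros-closed : ∀ {a} → (∀ n → 2 * g ∸ 1 < n → a n ≡ 0) →
    SubadditiveUpTo g (2 * g ∸ 1) a →
    ∀ i j → a i ≡ 0 → a j ≡ 0 → a (i + j) ≡ 0
  subadditive⇒zeros-closed {a} a-beyond sub = zeros-closed
    where
    ordered-case : ∀ i j → 1 ≤ i → i ≤ j → a i ≡ 0 → a j ≡ 0 → a (i + j) ≡ 0
    ordered-case i j 1≤i i≤j ai≡0 aj≡0 with i + j ≤? 2 * g ∸ 1
    ... | no  i+j≰ = a-beyond (i + j) (≰⇒> i+j≰)
    ... | yes i+j≤ = n≤0⇒n≡0 (subst (a (i + j) ≤_) (cong₂ _+_ ai≡0 aj≡0)
                       (sub i j 1≤i i≤j (≤∸1⇒< 0<2g (≤-trans (m≤n+m j i) i+j≤)) i+j≤))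
    zeros-closed : ∀ i j → a i ≡ 0 → a j ≡ 0 → a (i + j) ≡ 0
    zeros-closed zero    j       _    aj≡0 = aj≡0
    zeros-closed (suc i) zero    ai≡0 _    = subst (λ n → a n ≡ 0) (sym (+-identityʳ (suc i))) ai≡0
    zeros-closed (suc i) (suc j) ai≡0 aj≡0 with ≤-total i j
    ... | inj₁ i≤j = ordered-case (suc i) (suc j) (s≤s z≤n) (s≤s i≤j) ai≡0 aj≡0
    ... | inj₂ j≤i = subst (λ n → a n ≡ 0) (+-comm (suc j) (suc i))
                       (ordered-case (suc j) (suc i) (s≤s z≤n) (s≤s j≤i) aj≡0 ai≡0)

  cond1⇔cond2×lastNonzeroAt : ∀ {F x} → F ≤ 2 * g ∸ 1 →
    Cond1 F g x ⇔ (Cond2 g x × LastNonzeroAt F g x)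
  cond1⇔cond2×lastNonzeroAt {F} {x} F≤ = mk⇔
    (λ (x≤1 , xF≡1 , x≗0 , sub , sum≡g) →
      (x≤1 , subadditive-extend sub x≗0 , trans (sum-tail x≗0) sum≡g) , (xF≡1 , x≗0))
    (λ ((x≤1 , sub , sum≡g) , (xF≡1 , x≗0)) →
      x≤1 , xF≡1 , x≗0 , (λ i j 1≤i i≤j j<2g i+j≤F → sub i j 1≤i i≤j j<2g (≤-trans i+j≤F F≤)) ,
      trans (sym (sum-tail x≗0)) sum≡g)
    where
    sum-tail : (∀ i → F < i → i < 2 * g → at x i ≡ 0) → sum1 (at x) (2 * g ∸ 1) ≡ sum1 (at x) F
    sum-tail x≗0 = sum1-vanish F≤ (λ i F<i i≤ → x≗0 i F<i (≤∸1⇒< 0<2g i≤))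

  hasFrobenius⇔lastNonzeroAt : ∀ {F S x} → 1 ≤ F → F ≤ 2 * g ∸ 1 → HasGenus S g → IsKunz S g x →
    HasFrobenius S F ⇔ LastNonzeroAt F g x
  hasFrobenius⇔lastNonzeroAt {F} {S} {x} 1≤F F≤ genus K = mk⇔
    (λ (F∉S , beyondF∈S) →
      trans (x≗gap F 1≤F F≤) (from (gap≡1⇔∉ S) F∉S) ,
      λ i F<i i<2g → trans (x≗gap i (≤-trans 1≤F (<⇒≤ F<i)) (<⇒≤∸1 i<2g))
                           (from (gap≡0⇔∈ S) (beyondF∈S i F<i)))
    (λ (xF≡1 , x≗0) → to (gap≡1⇔∉ S) (trans (sym (x≗gap F 1≤F F≤)) xF≡1) , beyondF∈S x≗0)
    where
    tail = genus-tail S genus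
    x≗gap = to (isKunz⇔gap S g tail) K
    beyondF∈S : (∀ i → F < i → i < 2 * g → at x i ≡ 0) → ∀ n → F < n → mem S n ≡ true
    beyondF∈S x≗0 n F<n with n <? 2 * g
    ... | yes n<2g = to (gap≡0⇔∈ S)
                       (trans (sym (x≗gap n (≤-trans 1≤F (<⇒≤ F<n)) (<⇒≤∸1 n<2g))) (x≗0 n F<n n<2g))
    ... | no  n≮2g = tail n (≮⇒≥ n≮2g)

  inKg⇒cond2 : ∀ {x} → InKg g x → Cond2 g x
  inKg⇒cond2 {x} (S , genus , K) = x≤1 , subadditive , sum≡g
    where
    x≗gap = to (isKunz⇔gap S g (genus-tail S genus)) K
    x≤1 : ∀ k → x k ≤ 1
    x≤1 k = subst (_≤ 1) (trans (sym (x≗gap (suc (toℕ k)) (s≤s z≤n) (toℕ<n k))) (at-toℕ x k))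
                  (gap≤1 S _)
    subadditive : SubadditiveUpTo g (2 * g ∸ 1) (at x)
    subadditive i j 1≤i i≤j j<2g i+j≤ = begin
      at x (i + j)      ≡⟨ x≗gap (i + j) (≤-trans 1≤i (m≤m+n i j)) i+j≤ ⟩
      gap S (i + j)     ≤⟨ gap-+ S i j ⟩
      gap S i + gap S j ≡⟨ cong₂ _+_ (x≗gap i 1≤i (≤-trans i≤j j≤)) (x≗gap j (≤-trans 1≤i i≤j) j≤) ⟨
      at x i + at x j   ∎
      where
      open ≤-Reasoning
      j≤ = <⇒≤∸1 j<2g
    sum≡g : sum1 (at x) (2 * g ∸ 1) ≡ g
    sum≡g = trans (sum1-cong _ x≗gap) (sym (genus≡sum1-gap S genus))

  cond2⇒inKg : ∀ {x} → Cond2 g x → InKg g x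
  cond2⇒inKg {x} (x≤1 , sub , sum≡g) =
    zerosOf , subst (HasGenus zerosOf) sum≡g (zerosOf-hasGenus a≤1) ,
    from (isKunz⇔gap zerosOf g tail) (λ i _ _ → sym (gap-zerosOf a≤1 i))
    where
    open ZerosOf (at x) refl (subadditive⇒zeros-closed (at-beyond x) sub) (at-beyond x)
    a≤1 = at≤1 x x≤1
    tail : ∀ n → 2 * g ≤ n → mem zerosOf n ≡ true
    tail n 2g≤n = zerosOf-tail n (<-≤-trans (≤∸1⇒< 0<2g ≤-refl) 2g≤n)

lemma15 : (F g : ℕ) → 0 < F → 0 < g → g ≤ F → F ≤ 2 * g ∸ 1 →
    ((x : Fin (2 * g ∸ 1) → ℕ) → InKFg F g x ⇔ Cond1 F g x) ×
    ((x : Fin (2 * g ∸ 1) → ℕ) → InKg g x ⇔ Cond2 g x)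
lemma15 F g 0<F 0<g _ F≤ = (λ x → mk⇔ (inKFg⇒cond1 x) (cond1⇒inKFg x)) ,
                            (λ x → mk⇔ (inKg⇒cond2 0<g) (cond2⇒inKg 0<g))
  where
  inKFg⇒cond1 : ∀ x → InKFg F g x → Cond1 F g x
  inKFg⇒cond1 x (S , frob , genus , K) = from (cond1⇔cond2×lastNonzeroAt 0<g {x = x} F≤)
    (inKg⇒cond2 0<g (S , genus , K) ,
     to (hasFrobenius⇔lastNonzeroAt 0<g {S = S} {x} 0<F F≤ genus K) frob)
  cond1⇒inKFg : ∀ x → Cond1 F g x → InKFg F g x
  cond1⇒inKFg x c1 with c2 , last ← to (cond1⇔cond2×lastNonzeroAt 0<g {x = x} F≤) c1
                   with S , genus , K ← cond2⇒inKg 0<g c2 =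
    S , from (hasFrobenius⇔lastNonzeroAt 0<g {S = S} {x} 0<F F≤ genus K) last , genus , K
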